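{- Let $G=(V,E)$ be a graph, $C$ a minimum vertex cover of $G$, and $(L^C,X^C,R^C)$ a partition of $C$ into three parts. Let $(P,\{X_i\})$ be a nice path decomposition of $G$ having some node whose trace on $C$ is $(L^C,X^C,R^C)$. Then the set of nodes of $P$ whose trace on $C$ is $(L^C,X^C,R^C)$ induces a connected subpath of $P$, from a lower node $imin$ to an upper node $imax$.
   Context: A path decomposition of $G$ is a tree decomposition $(P,\{X_i\})$ whose tree $P$ is a path: every vertex lies in some bag, every edge has both endpoints in some bag, and for each vertex the nodes whose bags contain it form a connected subpath. It is rooted at one end. A nice path decomposition is a rooted path decomposition in which the lowest node $i$ has $|X_i|=1$ and every other node $i$, with unique child $j$, is either an introduce node ($X_i=X_j\cup\{u\}$ for some $u\notin X_j$) or a forget node ($X_i=X_j\setminus\{u\}$ for some $u\in X_j$). For a node $i$, let $V_i$ be the union of the bags at $i$ and below, $L_i=V_i\setminus X_i$, $R_i=V\setminus V_i$; the trace of $i$ on $C$ is $(L_i\cap C,X_i\cap C,R_i\cap C)$. -}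

module Defs where

open import Data.Nat using (ℕ; zero; suc)
import Data.Nat
open import Data.Fin using (Fin; toℕ; inject₁) renaming (suc to fsuc; zero to fzero)
open import Data.Fin.Subset using (Subset; _∈_; _∉_; _∩_; _∪_; ∁; ⋃; ∣_∣; ⁅_⁆)
open import Data.Product using (Σ; ∃; _×_; _,_)
open import Data.Sum using (_⊎_)
open import Data.Empty using (⊥)
open import Relation.Nullary using (¬_)
open import Relation.Binary.PropositionalEquality using (_≡_)
import Data.List as L
import Data.Fin as F

record Graph (n : ℕ) : Set₁ where
  field
    Adj   : Fin n → Fin n → Set
    sym   : ∀ {u v} → Adj u v → Adj v u
    irrefl : ∀ {u} → ¬ Adj u u
open Graph public

VertexCover : ∀ {n} → Graph n → Subset n → Set
VertexCover G C = ∀ u v → Adj G u v → (u ∈ C) ⊎ (v ∈ C)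

MinimumVertexCover : ∀ {n} → Graph n → Subset n → Set
MinimumVertexCover G C =
  VertexCover G C × (∀ C′ → VertexCover G C′ → ∣ C ∣ Data.Nat.≤ ∣ C′ ∣)

Partition3 : ∀ {n} → Subset n → Subset n → Subset n → Subset n → Set
Partition3 C A B D =
  ((A ∪ B) ∪ D ≡ C) × (∀ v → ¬ (v ∈ A × v ∈ B)) × (∀ v → ¬ (v ∈ A × v ∈ D))
  × (∀ v → ¬ (v ∈ B × v ∈ D))

-- A rooted path decomposition with k nodes, node 0 the lowest node and
-- node k-1 the root; the child of node i+1 is node i.
record PathDecomposition {n} (G : Graph n) (k : ℕ) : Set where
  field
    bag : Fin k → Subset n
    covers-vertices : ∀ v → ∃ λ i → v ∈ bag i
    covers-edges : ∀ u v → Adj G u v → ∃ λ i → (u ∈ bag i) × (v ∈ bag i)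
    connected : ∀ v (i j l : Fin k) → i F.≤ j → j F.≤ l →
                v ∈ bag i → v ∈ bag l → v ∈ bag j
open PathDecomposition public

IntroduceNode : ∀ {n} → Subset n → Subset n → Set
IntroduceNode Xi Xj = ∃ λ u → u ∉ Xj × (Xi ≡ Xj ∪ ⁅ u ⁆)

ForgetNode : ∀ {n} → Subset n → Subset n → Set
ForgetNode Xi Xj = ∃ λ u → u ∈ Xj × (Xi ≡ Xj ∩ ∁ ⁅ u ⁆)

record NicePathDecomposition {n} (G : Graph n) (m : ℕ) : Set where
  field
    pd : PathDecomposition G (suc m)
    lowest-size : ∣ bag pd fzero ∣ ≡ 1
    step : ∀ (i : Fin m) →
      IntroduceNode (bag pd (fsuc i)) (bag pd (inject₁ i))
      ⊎ ForgetNode (bag pd (fsuc i)) (bag pd (inject₁ i))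
open NicePathDecomposition public

Vbelow : ∀ {n k} → (Fin k → Subset n) → Fin k → Subset n
Vbelow X i = ⋃ (L.map X (L.filter (λ j → j F.≤? i) (L.allFin _)))

-- trace of node i on C : (L_i ∩ C , X_i ∩ C , R_i ∩ C)
trace : ∀ {n k} → (Fin k → Subset n) → Subset n → Fin k →
        Subset n × Subset n × Subset n
trace X C i =
  ((Vbelow X i ∩ ∁ (X i)) ∩ C) , (X i ∩ C) , (∁ (Vbelow X i) ∩ C)

module Submission where

-- The trace of a node i on C is determined by V_i ∩ C and X_i ∩ C.  Along the path V_i
-- only grows, and by connectivity of the bags a vertex of V_i that occurs in a later bag
-- already lies in X_i.  So if nodes i ≤ l have the same trace, both V_j ∩ C and X_j ∩ C are
-- squeezed to the common value for every j between them: the nodes with a given trace form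
-- a convex, decidable, nonempty subset of the path, i.e. the interval between its least and
-- greatest element.

open import Defs
open import Level using (Level)
open import Data.Nat using (ℕ; suc; z≤n; s≤s)
open import Data.Fin using (Fin; _≤_; _≤?_) renaming (zero to fzero; suc to fsuc)
open import Data.Fin.Properties using (≤-refl; ≤-trans; any?)
open import Data.Fin.Subset using (Subset; _∈_; _⊆_; _∩_; ∁; ⋃)
open import Data.Fin.Subset.Properties
  using (⊆-antisym; ∉⊥; x∈p∪q⁺; x∈p∪q⁻; x∈p∩q⁺; x∈p∩q⁻; x∈∁p⇒x∉p; x∉p⇒x∈∁p; x∉∁p⇒x∈p; x∈p⇒x∉∁p)
open import Data.Bool using () renaming (_≟_ to _≟ᵇ_)
open import Data.Vec.Properties using () renaming (≡-dec to Vec-≡-dec)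
open import Data.Product.Properties using () renaming (≡-dec to ×-≡-dec)
open import Data.List using (List; []; _∷_; map; filter; allFin)
open import Data.List.Membership.Propositional using () renaming (_∈_ to _∈ₗ_)
open import Data.List.Membership.Propositional.Properties
  using (∈-map⁺; ∈-map⁻; ∈-filter⁺; ∈-filter⁻; ∈-allFin)
open import Data.List.Relation.Unary.Any using (here; there)
open import Data.Product using (∃; _×_; _,_; proj₁; proj₂)
open import Data.Sum using (inj₁; inj₂)
open import Data.Empty using (⊥-elim)
open import Function.Bundles using (_⇔_; mk⇔; module Equivalence)
open import Relation.Nullary using (yes; no)
open import Relation.Unary using (Pred; Decidable)
open import Relation.Binary.PropositionalEquality using (_≡_; refl; trans; cong; cong₂; subst)
import Relation.Binary.PropositionalEquality as ≡

open Equivalence using (to; from)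

private
  variable
    ℓ : Level
    n k : ℕ
    x : Fin n
    p q r p′ q′ : Subset n

x∈⋃⁺ : {ps : List (Subset n)} → p ∈ₗ ps → x ∈ p → x ∈ ⋃ ps
x∈⋃⁺ (here refl) x∈p = x∈p∪q⁺ (inj₁ x∈p)
x∈⋃⁺ (there p∈ps) x∈p = x∈p∪q⁺ (inj₂ (x∈⋃⁺ p∈ps x∈p))

x∈⋃⁻ : (ps : List (Subset n)) → x ∈ ⋃ ps → ∃ λ p → p ∈ₗ ps × x ∈ p
x∈⋃⁻ [] x∈⊥ = ⊥-elim (∉⊥ x∈⊥)
x∈⋃⁻ (p ∷ ps) x∈⋃ with x∈p∪q⁻ p (⋃ ps) x∈⋃
... | inj₁ x∈p = p , here refl , x∈p
... | inj₂ x∈⋃ps with x∈⋃⁻ ps x∈⋃ps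
...   | q , q∈ps , x∈q = q , there q∈ps , x∈q

AgreeOn : Subset n → Subset n → Subset n → Set
AgreeOn r p q = ∀ {x} → x ∈ r → x ∈ p ⇔ x ∈ q

agreeOn-sym : AgreeOn r p q → AgreeOn r q p
agreeOn-sym p≈q x∈r = mk⇔ (from (p≈q x∈r)) (to (p≈q x∈r))

agreeOn⇒∩⊆∩ : ∀ (p q r : Subset n) → AgreeOn r p q → p ∩ r ⊆ q ∩ r
agreeOn⇒∩⊆∩ p q r p≈q x∈p∩r with x∈p∩q⁻ p r x∈p∩r
... | x∈p , x∈r = x∈p∩q⁺ (to (p≈q x∈r) x∈p , x∈r)

agreeOn⇒∩≡ : AgreeOn r p q → p ∩ r ≡ q ∩ r
agreeOn⇒∩≡ {r = r} {p} {q} p≈q = ⊆-antisym (agreeOn⇒∩⊆∩ p q r p≈q) (agreeOn⇒∩⊆∩ q p r (agreeOn-sym p≈q))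

∩≡⇒agreeOn : ∀ (p q r : Subset n) → p ∩ r ≡ q ∩ r → AgreeOn r p q
∩≡⇒agreeOn p q r p∩r≡q∩r {x} x∈r = mk⇔ (transport p q p∩r≡q∩r) (transport q p (≡.sym p∩r≡q∩r))
  where
  transport : ∀ s t → s ∩ r ≡ t ∩ r → x ∈ s → x ∈ t
  transport s t eq x∈s = proj₁ (x∈p∩q⁻ t r (subst (x ∈_) eq (x∈p∩q⁺ (x∈s , x∈r))))

agreeOn-∩ : AgreeOn r p q → AgreeOn r p′ q′ → AgreeOn r (p ∩ p′) (q ∩ q′)
agreeOn-∩ {p = p} {q} {p′} {q′} p≈q p′≈q′ x∈r = mk⇔
  (λ x∈pp′ → let x∈p , x∈p′ = x∈p∩q⁻ p p′ x∈pp′ in x∈p∩q⁺ (to (p≈q x∈r) x∈p , to (p′≈q′ x∈r) x∈p′))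
  (λ x∈qq′ → let x∈q , x∈q′ = x∈p∩q⁻ q q′ x∈qq′ in x∈p∩q⁺ (from (p≈q x∈r) x∈q , from (p′≈q′ x∈r) x∈q′))

agreeOn-∁ : AgreeOn r p q → AgreeOn r (∁ p) (∁ q)
agreeOn-∁ p≈q x∈r = mk⇔
  (λ x∈∁p → x∉p⇒x∈∁p (λ x∈q → x∈∁p⇒x∉p x∈∁p (from (p≈q x∈r) x∈q)))
  (λ x∈∁q → x∉p⇒x∈∁p (λ x∈p → x∈∁p⇒x∉p x∈∁q (to (p≈q x∈r) x∈p)))

agreeOn-∁⁻ : AgreeOn r (∁ p) (∁ q) → AgreeOn r p q
agreeOn-∁⁻ ∁p≈∁q x∈r = mk⇔
  (λ x∈p → x∉∁p⇒x∈p (λ x∈∁q → x∈p⇒x∉∁p x∈p (from (∁p≈∁q x∈r) x∈∁q)))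
  (λ x∈q → x∉∁p⇒x∈p (λ x∈∁p → x∈p⇒x∉∁p x∈q (to (∁p≈∁q x∈r) x∈∁p)))

module _ (X : Fin k → Subset n) (C : Subset n) {i j : Fin k} where

  trace-≡ : AgreeOn C (Vbelow X i) (Vbelow X j) → AgreeOn C (X i) (X j) →
            trace X C i ≡ trace X C j
  trace-≡ V≈ X≈ = cong₂ _,_ (agreeOn⇒∩≡ (agreeOn-∩ V≈ (agreeOn-∁ X≈)))
                            (cong₂ _,_ (agreeOn⇒∩≡ X≈) (agreeOn⇒∩≡ (agreeOn-∁ V≈)))

  trace-≡⁻ : trace X C i ≡ trace X C j →
             AgreeOn C (Vbelow X i) (Vbelow X j) × AgreeOn C (X i) (X j)
  trace-≡⁻ eq = agreeOn-∁⁻ (∩≡⇒agreeOn _ _ C (cong (λ t → proj₂ (proj₂ t)) eq))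
              , ∩≡⇒agreeOn _ _ C (cong (λ t → proj₁ (proj₂ t)) eq)

module _ (X : Fin k → Subset n) where

  ∈Vbelow⁺ : ∀ {i j} → j ≤ i → x ∈ X j → x ∈ Vbelow X i
  ∈Vbelow⁺ {i = i} {j} j≤i = x∈⋃⁺ (∈-map⁺ X (∈-filter⁺ (_≤? i) (∈-allFin j) j≤i))

  ∈Vbelow⁻ : ∀ i → x ∈ Vbelow X i → ∃ λ j → j ≤ i × x ∈ X j
  ∈Vbelow⁻ i x∈V with x∈⋃⁻ (map X (filter (_≤? i) (allFin k))) x∈V
  ... | _ , Xj∈ , x∈Xj with ∈-map⁻ X Xj∈
  ...   | j , j∈ , refl = j , proj₂ (∈-filter⁻ (_≤? i) {xs = allFin k} j∈) , x∈Xj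

  X⊆Vbelow : ∀ i → X i ⊆ Vbelow X i
  X⊆Vbelow i = ∈Vbelow⁺ ≤-refl

  Vbelow-mono : ∀ {i j} → i ≤ j → Vbelow X i ⊆ Vbelow X j
  Vbelow-mono {i} i≤j x∈V with ∈Vbelow⁻ i x∈V
  ... | t , t≤i , x∈Xt = ∈Vbelow⁺ (≤-trans t≤i i≤j) x∈Xt

BagsConnected : (Fin k → Subset n) → Set
BagsConnected X = ∀ v i j l → i ≤ j → j ≤ l → v ∈ X i → v ∈ X l → v ∈ X j

module _ {X : Fin k → Subset n} (connected : BagsConnected X) where

  ∈Vbelow∩later⇒∈X : ∀ {i j} → i ≤ j → x ∈ Vbelow X i → x ∈ X j → x ∈ X i
  ∈Vbelow∩later⇒∈X {x = x} {i} {j} i≤j x∈Vi x∈Xj with ∈Vbelow⁻ X i x∈Vi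
  ... | t , t≤i , x∈Xt = connected x t i j t≤i i≤j x∈Xt x∈Xj

  trace-convex : ∀ (C : Subset n) {i j l} → i ≤ j → j ≤ l →
                 trace X C i ≡ trace X C l → trace X C j ≡ trace X C i
  trace-convex C {i} {j} {l} i≤j j≤l trᵢ≡trₗ = trace-≡ X C Vⱼ≈Vᵢ Xⱼ≈Xᵢ
    where
    Vᵢ≈Vₗ : AgreeOn C (Vbelow X i) (Vbelow X l)
    Vᵢ≈Vₗ = proj₁ (trace-≡⁻ X C trᵢ≡trₗ)

    Xᵢ≈Xₗ : AgreeOn C (X i) (X l)
    Xᵢ≈Xₗ = proj₂ (trace-≡⁻ X C trᵢ≡trₗ)

    Vⱼ≈Vᵢ : AgreeOn C (Vbelow X j) (Vbelow X i)
    Vⱼ≈Vᵢ x∈C = mk⇔ (λ x∈Vⱼ → from (Vᵢ≈Vₗ x∈C) (Vbelow-mono X j≤l x∈Vⱼ)) (Vbelow-mono X i≤j)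

    Xⱼ≈Xᵢ : AgreeOn C (X j) (X i)
    Xⱼ≈Xᵢ {x} x∈C = mk⇔
      (λ x∈Xⱼ → ∈Vbelow∩later⇒∈X i≤j (to (Vⱼ≈Vᵢ x∈C) (X⊆Vbelow X j x∈Xⱼ)) x∈Xⱼ)
      (λ x∈Xᵢ → connected x i j l i≤j j≤l x∈Xᵢ (to (Xᵢ≈Xₗ x∈C) x∈Xᵢ))

least : (P : Pred (Fin k) ℓ) → Decidable P → ∃ P → ∃ λ i → P i × (∀ j → P j → i ≤ j)
least {k = suc k} P P? (i , Pi) with P? fzero
least {k = suc k} P P? (i , Pi) | yes P0 = fzero , P0 , λ _ _ → z≤n
least {k = suc k} P P? (fzero , P0) | no ¬P0 = ⊥-elim (¬P0 P0)
least {k = suc k} P P? (fsuc i , Pi) | no ¬P0 with least (λ j → P (fsuc j)) (λ j → P? (fsuc j)) (i , Pi)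
... | j , Pj , j-least = fsuc j , Pj , λ where
  fzero P0 → ⊥-elim (¬P0 P0)
  (fsuc t) Pt → s≤s (j-least t Pt)

greatest : (P : Pred (Fin k) ℓ) → Decidable P → ∃ P → ∃ λ i → P i × (∀ j → P j → j ≤ i)
greatest {k = suc k} P P? (i , Pi) with any? (λ j → P? (fsuc j))
... | yes ∃Psuc with greatest (λ j → P (fsuc j)) (λ j → P? (fsuc j)) ∃Psuc
...   | j , Pj , j-greatest = fsuc j , Pj , λ where
  fzero _ → z≤n
  (fsuc t) Pt → s≤s (j-greatest t Pt)
greatest {k = suc k} P P? (fzero , P0) | no ¬∃Psuc = fzero , P0 , λ where
  fzero _ → z≤n
  (fsuc t) Pt → ⊥-elim (¬∃Psuc (t , Pt))
greatest {k = suc k} P P? (fsuc i , Pi) | no ¬∃Psuc = ⊥-elim (¬∃Psuc (i , Pi))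

Convex : Pred (Fin k) ℓ → Set ℓ
Convex P = ∀ {i j l} → i ≤ j → j ≤ l → P i → P l → P j

convex⇒interval : (P : Pred (Fin k) ℓ) → Decidable P → Convex P → ∃ P →
                  ∃ λ a → ∃ λ b → a ≤ b × (∀ i → P i ⇔ (a ≤ i × i ≤ b))
convex⇒interval P P? convex ∃P with least P P? ∃P | greatest P P? ∃P
... | a , Pa , a-least | b , Pb , b-greatest =
  a , b , a-least b Pb , λ i → mk⇔ (λ Pi → a-least i Pi , b-greatest i Pi)
                                   (λ (a≤i , i≤b) → convex a≤i i≤b Pa Pb)

lemma7 : ∀ {n m} (G : Graph n) (C LC XC RC : Subset n) →
    MinimumVertexCover G C →
    Partition3 C LC XC RC →
    (N : NicePathDecomposition G m) →
    (∃ λ i → trace (bag (pd N)) C i ≡ (LC , XC , RC)) →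
    ∃ λ (imin : Fin (suc m)) → ∃ λ (imax : Fin (suc m)) → imin ≤ imax ×
    (∀ i → (trace (bag (pd N)) C i ≡ (LC , XC , RC)) ⇔ (imin ≤ i × i ≤ imax))
lemma7 G C LC XC RC _ _ N = convex⇒interval HasTrace hasTrace? hasTrace-convex
  where
  X = bag (pd N)

  HasTrace : Pred (Fin _) _
  HasTrace i = trace X C i ≡ (LC , XC , RC)

  hasTrace? : Decidable HasTrace
  hasTrace? i = ×-≡-dec subset-≟ (×-≡-dec subset-≟ subset-≟) (trace X C i) (LC , XC , RC)
    where subset-≟ = Vec-≡-dec _≟ᵇ_

  hasTrace-convex : Convex HasTrace
  hasTrace-convex i≤j j≤l trᵢ≡T trₗ≡T =
    trans (trace-convex (connected (pd N)) C i≤j j≤l (trans trᵢ≡T (≡.sym trₗ≡T))) trᵢ≡T
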